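{- For all $e,x\in\mathbb{Z}^+$, the preimage $S_{e,!}^{ -1}(x)=\{y\in\mathbb{Z}^+ : S_{e,!}(y)=x\}$ is nonempty.
   Context: Every positive integer $n$ has a unique factorial base representation $n=\sum_{i=1}^k a_i\cdot i!$ with $a_k\neq 0$ and $0\leq a_i\leq i$ for $1\leq i\leq k$. For an integer $e\geq 1$, define $S_{e,!}:\mathbb{Z}_{\geq 0}\to\mathbb{Z}_{\geq 0}$ by $S_{e,!}(0)=0$ and $S_{e,!}(n)=\sum_{i=1}^k a_i^e$ for $n\geq 1$. -}

module Defs where

open import Data.Nat using (ℕ; zero; suc; _+_; _^_)
open import Data.Nat.DivMod using (_/_; _%_)
open import Data.List using (List; []; _∷_; map)
open import Data.Nat.ListAction using (sum)

-- Factorial base digits of n, least significant first: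
-- facDigitsFrom i fuel n = [a_i, a_{i+1}, ...] where the current value n
-- is to be written as Σ_{j≥i} a_j * (j! / (i-1)!).  Fuel is only for
-- termination; fuel n suffices since the value at least halves each step.
facDigitsFrom : ℕ → ℕ → ℕ → List ℕ
facDigitsFrom i zero    n    = []
facDigitsFrom i (suc f) zero = []
facDigitsFrom i (suc f) (suc m) =
  (suc m % suc i) ∷ facDigitsFrom (suc i) f (suc m / suc i)

-- facDigits n = [a_1, a_2, ..., a_k] with n = Σ a_i * i!, 0 ≤ a_i ≤ i,
-- a_k ≠ 0 (and [] for n = 0).
facDigits : ℕ → List ℕ
facDigits n = facDigitsFrom 1 n n

S! : ℕ → ℕ → ℕ
S! e n = sum (map (λ a → a ^ e) (facDigits n))

{-# OPTIONS --safe #-}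
module Submission where

-- Every factorial digit of y = 1! + 2! + ⋯ + x! equals 1, so S_{e,!}(y) is the
-- number of digits, x, whatever the exponent e.

open import Defs
open import Data.Nat using (ℕ; _≥_; zero; suc; _+_; _*_; _^_; _≤_; z≤n; s≤s)
open import Data.Nat.Properties using (≤-trans; m≤m*n; ^-zeroˡ)
open import Data.Nat.DivMod using (_/_; _%_; [m+kn]%n≡m%n; m<n⇒m%n≡m; m<n⇒m/n≡0; +-distrib-/-∣ʳ; m*n/n≡m)
open import Data.Nat.Divisibility using (divides-refl)
open import Data.List using (_∷_; map; replicate)
open import Data.List.Properties using (map-replicate)
open import Data.Nat.ListAction using (sum)
open import Data.Product using (∃-syntax; _×_; _,_)
open import Relation.Binary.PropositionalEquality using (_≡_; refl; cong; cong₂; trans; module ≡-Reasoning)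

-- The number whose factorial digits from position i on are k ones, in the
-- scaled form consumed by facDigitsFrom i: 1 + (i+1)(1 + (i+2)(1 + ⋯)).
onesFrom : ℕ → ℕ → ℕ
onesFrom i zero    = 0
onesFrom i (suc k) = 1 + onesFrom (suc i) k * suc i

k≤onesFrom : ∀ i k → k ≤ onesFrom i k
k≤onesFrom i zero    = z≤n
k≤onesFrom i (suc k) =
  s≤s (≤-trans (k≤onesFrom (suc i) k) (m≤m*n (onesFrom (suc i) k) (suc i)))

module _ (t n : ℕ) where

  [1+t*2+n]%2+n≡1 : (1 + t * suc (suc n)) % suc (suc n) ≡ 1
  [1+t*2+n]%2+n≡1 =
    trans ([m+kn]%n≡m%n 1 t (suc (suc n))) (m<n⇒m%n≡m {n = suc (suc n)} {m = 1} (s≤s (s≤s z≤n)))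

  [1+t*2+n]/2+n≡t : (1 + t * suc (suc n)) / suc (suc n) ≡ t
  [1+t*2+n]/2+n≡t =
    trans (+-distrib-/-∣ʳ 1 {d = suc (suc n)} (divides-refl t))
          (cong₂ _+_ (m<n⇒m/n≡0 {1} {suc (suc n)} (s≤s (s≤s z≤n))) (m*n/n≡m t (suc (suc n))))

facDigitsFrom-onesFrom : ∀ i k fuel → k ≤ fuel →
  facDigitsFrom (suc i) fuel (onesFrom (suc i) k) ≡ replicate k 1
facDigitsFrom-onesFrom i zero    zero       _         = refl
facDigitsFrom-onesFrom i zero    (suc fuel) _         = refl
facDigitsFrom-onesFrom i (suc k) (suc fuel) (s≤s k≤fuel) = begin
  facDigitsFrom (suc i) (suc fuel) (1 + t * suc (suc i))
    ≡⟨⟩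
  (1 + t * suc (suc i)) % suc (suc i)
    ∷ facDigitsFrom (suc (suc i)) fuel ((1 + t * suc (suc i)) / suc (suc i))
    ≡⟨ cong₂ _∷_ ([1+t*2+n]%2+n≡1 t i)
                 (cong (facDigitsFrom (suc (suc i)) fuel) ([1+t*2+n]/2+n≡t t i)) ⟩
  1 ∷ facDigitsFrom (suc (suc i)) fuel t
    ≡⟨ cong (1 ∷_) (facDigitsFrom-onesFrom (suc i) k fuel k≤fuel) ⟩
  replicate (suc k) 1 ∎
  where
  open ≡-Reasoning
  t = onesFrom (suc (suc i)) k

facDigits-onesFrom : ∀ k → facDigits (onesFrom 1 k) ≡ replicate k 1
facDigits-onesFrom k = facDigitsFrom-onesFrom 0 k (onesFrom 1 k) (k≤onesFrom 1 k)

sum-replicate-1 : ∀ k → sum (replicate k 1) ≡ k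
sum-replicate-1 zero    = refl
sum-replicate-1 (suc k) = cong suc (sum-replicate-1 k)

S!-onesFrom : ∀ e k → S! e (onesFrom 1 k) ≡ k
S!-onesFrom e k = begin
  sum (map (_^ e) (facDigits (onesFrom 1 k))) ≡⟨ cong (λ ds → sum (map (_^ e) ds)) (facDigits-onesFrom k) ⟩
  sum (map (_^ e) (replicate k 1))            ≡⟨ cong sum (map-replicate (_^ e) k 1) ⟩
  sum (replicate k (1 ^ e))                   ≡⟨ cong (λ a → sum (replicate k a)) (^-zeroˡ e) ⟩
  sum (replicate k 1)                         ≡⟨ sum-replicate-1 k ⟩
  k ∎
  where open ≡-Reasoning

lemma3p3 : (e x : ℕ) → e ≥ 1 → x ≥ 1 → ∃[ y ] (y ≥ 1 × S! e y ≡ x)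
lemma3p3 e x _ x≥1 = onesFrom 1 x , ≤-trans x≥1 (k≤onesFrom 1 x) , S!-onesFrom e x
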